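{- Let $S$ be a finite GCD closed set of distinct positive integers which is a $\wedge$-tree set. Then the LCM matrix $[S]$ is invertible.
   Context: $S$ is GCD closed if $\gcd(x,y)\in S$ for all $x,y\in S$. $S$ is a $\wedge$-tree set if the Hasse diagram of the poset $(\mathrm{meetcl}(S),\mid)$ (here equal to $(S,\mid)$, with meet $\gcd$) is a tree. The LCM matrix $[S]$ of $S=\{x_1,\ldots,x_n\}$ is the $n\times n$ matrix with $(i,j)$ entry $\mathrm{lcm}(x_i,x_j)$. -}

module Defs where

open import Data.Nat using (ℕ; zero; suc; _≤_; _<_)
open import Data.Nat.Divisibility using (_∣_)
open import Data.Nat.GCD using (gcd)
open import Data.Nat.LCM using (lcm)
open import Data.Fin using (Fin; zero; suc)
open import Data.List using (List; []; _∷_; length; last)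
open import Data.List.Relation.Unary.Unique.Propositional using (Unique)
open import Data.Maybe using (just)
open import Data.Product using (Σ; ∃; _×_; _,_)
open import Data.Sum using (_⊎_)
open import Data.Empty using (⊥)
open import Data.Integer using (+_)
open import Data.Rational using (ℚ; 0ℚ; 1ℚ; _+_; _*_) renaming (_/_ to _/ℚ_)
open import Function.Definitions using (Injective)
open import Relation.Binary.PropositionalEquality using (_≡_; _≢_)
open import Relation.Nullary using (¬_)

-- A finite set S = {x_1,...,x_n} is given as an injective family x : Fin n → ℕ
-- (distinct elements), all positive.
DistinctPositive : ∀ {n} → (Fin n → ℕ) → Set
DistinctPositive {n} x = Injective _≡_ _≡_ x × (∀ i → 0 < x i)

GCDClosed : ∀ {n} → (Fin n → ℕ) → Set
GCDClosed {n} x = ∀ (i j : Fin n) → ∃ λ k → x k ≡ gcd (x i) (x j)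

Covers : ∀ {n} → (Fin n → ℕ) → Fin n → Fin n → Set
Covers {n} x i j =
  (x j ∣ x i) × (x j ≢ x i) ×
  (∀ (k : Fin n) → x j ∣ x k → x k ∣ x i → (x k ≡ x j) ⊎ (x k ≡ x i))

HasseAdj : ∀ {n} → (Fin n → ℕ) → Fin n → Fin n → Set
HasseAdj x i j = Covers x i j ⊎ Covers x j i

data Walk {n : ℕ} (E : Fin n → Fin n → Set) : Fin n → Fin n → Set where
  here  : ∀ {i} → Walk E i i
  step  : ∀ {i j k} → E i j → Walk E j k → Walk E i k

Connected : ∀ {n} → (Fin n → Fin n → Set) → Set
Connected {n} E = ∀ (i j : Fin n) → Walk E i j

Chain : ∀ {n} → (Fin n → Fin n → Set) → List (Fin n) → Set
Chain E [] = Data.Unit.⊤ where import Data.Unit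
Chain E (v ∷ []) = Data.Unit.⊤ where import Data.Unit
Chain E (v ∷ w ∷ vs) = E v w × Chain E (w ∷ vs)

IsCycle : ∀ {n} → (Fin n → Fin n → Set) → List (Fin n) → Set
IsCycle E [] = ⊥
IsCycle E (v ∷ vs) =
  (3 ≤ length (v ∷ vs)) × Unique (v ∷ vs) × Chain E (v ∷ vs) ×
  (∃ λ w → (last (v ∷ vs) ≡ just w) × E w v)

Acyclic : ∀ {n} → (Fin n → Fin n → Set) → Set
Acyclic {n} E = ∀ (c : List (Fin n)) → ¬ IsCycle E c

IsTree : ∀ {n} → (Fin n → Fin n → Set) → Set
IsTree E = Connected E × Acyclic E

-- S is a ∧-tree set: (S GCD closed, so meetcl(S) = S) the Hasse diagram of (S, ∣) is a tree.
MeetTreeSet : ∀ {n} → (Fin n → ℕ) → Set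
MeetTreeSet x = IsTree (HasseAdj x)

Matrix : ℕ → Set
Matrix n = Fin n → Fin n → ℚ

Σ-Fin : ∀ n → (Fin n → ℚ) → ℚ
Σ-Fin zero f = 0ℚ
Σ-Fin (suc n) f = f zero + Σ-Fin n (λ i → f (suc i))

_⊗_ : ∀ {n} → Matrix n → Matrix n → Matrix n
_⊗_ {n} A B i j = Σ-Fin n (λ k → A i k * B k j)

identity : ∀ {n} → Matrix n
identity zero zero = 1ℚ
identity zero (suc j) = 0ℚ
identity (suc i) zero = 0ℚ
identity (suc i) (suc j) = identity i j

Invertible : ∀ {n} → Matrix n → Set
Invertible {n} A = Σ (Matrix n) λ B → (∀ i j → (A ⊗ B) i j ≡ identity i j)
                                       × (∀ i j → (B ⊗ A) i j ≡ identity i j)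

ℕtoℚ : ℕ → ℚ
ℕtoℚ m = (+ m) /ℚ 1

LCMMatrix : ∀ {n} → (Fin n → ℕ) → Matrix n
LCMMatrix x i j = ℕtoℚ (lcm (x i) (x j))

module Submission where

-- Order S = {x_1,…,x_n} by divisibility, writing k ≼ i for
-- x_k ∣ x_i, and let zeta be its zeta matrix, zeta i k = [k ≼ i].
--  * Combinatorics: in a GCD closed ∧-tree set every element has at most one
--    lower cover, since two of them, a and b, together with the saturated
--    chains a ⋗ ⋯ ⋗ gcd(a,b) ⋖ ⋯ ⋖ b would close a cycle in the Hasse diagram.
--    Consequently every down-set is a chain, and below any i each j ≺ i has
--    exactly one upper cover.
--  * These counting facts say exactly that zeta is inverted by the Möbius
--    matrix möbius = identity − cover, where cover k j = [k covers j].
--  * Let α = möbius · (1/x), so that Σ_{k ≼ m} α_k = 1/x_m, and each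
--    α_k = 1/x_k − 1/x_parent(k) (or 1/x_k) is nonzero.  As gcd closure gives
--    k ≼ i ∧ k ≼ j ⟺ k ≼ meet i j, we get
--      lcm(x_i,x_j) = x_i x_j / x_{meet i j} = x_i x_j Σ_k [k ≼ i][k ≼ j] α_k,
--    i.e. [S] = diag(x) · zeta · diag(α) · zetaᵀ · diag(x), a product of
--    invertible matrices.

open import Defs
open import Algebra.Bundles using (CommutativeRing)
open import Data.Empty using (⊥; ⊥-elim)
open import Data.Fin using (Fin; zero; suc)
open import Data.Fin.Properties using (suc-injective; all?; any?) renaming (_≟_ to _≟ᶠ_)
open import Data.Integer using () renaming (+_ to +ℤ_)
import Data.Integer.Properties as ℤ
open import Data.List using (List; []; _∷_; _++_; length; last; filter; allFin)
import Data.List.Extrema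
open import Data.List.Membership.Propositional using (_∈_)
open import Data.List.Membership.Propositional.Properties using (∈-filter⁺; ∈-allFin)
open import Data.List.Relation.Unary.All as All using (All; []; _∷_)
import Data.List.Relation.Unary.All.Properties as All
open import Data.List.Relation.Unary.All.Properties using (all-filter)
open import Data.List.Relation.Unary.AllPairs as AllPairs using ([]; _∷_)
import Data.List.Relation.Unary.AllPairs.Properties as AllPairs
open import Data.List.Relation.Unary.Linked as Linked using (Linked; []; [-]; _∷_)
import Data.List.Relation.Unary.Linked.Properties as Linked
open import Data.List.Relation.Unary.Linked.Properties using (Linked⇒AllPairs)
open import Data.List.Relation.Unary.Unique.Propositional using (Unique)
open import Data.Maybe using (just)
open import Data.Maybe.Relation.Binary.Connected using (just) renaming (Connected to MaybeConnected)
import Data.Nat as ℕ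
open import Data.Nat using (ℕ; zero; suc; _≤_; _<_; _∸_; z<s; s≤s; _≟_; >-nonZero)
open import Data.Nat.Coprimality using (1-coprimeTo) renaming (sym to Coprime-sym)
open import Data.Nat.Divisibility using (_∣_; _∣?_; ∣-refl; ∣-trans; ∣-antisym; ∣⇒≤)
open import Data.Nat.GCD using (gcd; gcd[m,n]∣m; gcd[m,n]∣n; gcd-greatest)
open import Data.Nat.Induction using (<-wellFounded)
open import Data.Nat.LCM using (lcm; gcd*lcm)
open import Data.Nat.Properties using (≤-totalOrder; <-irrefl; <-≤-trans; ≤∧≢⇒<; ∸-monoʳ-<)
open import Data.Product using (Σ; _×_; _,_; proj₁; proj₂)
open import Data.Rational using (ℚ; mkℚ; 0ℚ; 1ℚ; _+_; _*_; -_; _-_; 1/_; _/_; ↥_; ≢-nonZero)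
import Data.Rational.Properties as ℚ
open import Data.Rational.Solver using (module +-*-Solver)
open import Data.Sum using (_⊎_; inj₁; inj₂)
open import Data.Unit using (tt)
open import Function using (_∘_)
open import Function.Definitions using (Injective)
open import Induction.WellFounded using (Acc; acc)
open import Relation.Binary.Definitions using (Transitive)
open import Relation.Binary.PropositionalEquality
open import Relation.Nullary using (Dec; yes; no; ¬_; contradiction)
open import Relation.Nullary.Decidable using (_×-dec_; _⊎-dec_; _→-dec_; ¬?)

open import Algebra.Properties.Group ℚ.+-0-group using (x∙y⁻¹≈ε⇒x≈y)
open +-*-Solver using (solve; _:+_; _:*_; :-_; _:=_)
open import Algebra.Properties.Semiring.Sum (CommutativeRing.semiring ℚ.+-*-commutativeRing)
  using (sum; ∑-distrib-+; ∑-comm; *-distribˡ-sum; *-distribʳ-sum)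

𝟙 : ∀ {P : Set} → Dec P → ℚ
𝟙 (yes _) = 1ℚ
𝟙 (no _)  = 0ℚ

𝟙-yes : ∀ {P : Set} (d : Dec P) → P → 𝟙 d ≡ 1ℚ
𝟙-yes (yes _) _ = refl
𝟙-yes (no ¬p) p = contradiction p ¬p

𝟙-no : ∀ {P : Set} (d : Dec P) → ¬ P → 𝟙 d ≡ 0ℚ
𝟙-no (yes p) ¬p = contradiction p ¬p
𝟙-no (no _)  _  = refl

𝟙-× : ∀ {P Q : Set} (p : Dec P) (q : Dec Q) → 𝟙 p * 𝟙 q ≡ 𝟙 (p ×-dec q)
𝟙-× (yes _) (yes _) = refl
𝟙-× (yes _) (no _)  = refl
𝟙-× (no _)  (yes _) = refl
𝟙-× (no _)  (no _)  = refl

𝟙-cong : ∀ {P Q : Set} (p : Dec P) (q : Dec Q) → (P → Q) → (Q → P) → 𝟙 p ≡ 𝟙 q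
𝟙-cong (yes _) (yes _) _   _   = refl
𝟙-cong (yes p) (no ¬q) p⇒q _   = contradiction (p⇒q p) ¬q
𝟙-cong (no ¬p) (yes q) _   q⇒p = contradiction (q⇒p q) ¬p
𝟙-cong (no _)  (no _)  _   _   = refl

Σ-Fin≡sum : ∀ n (f : Fin n → ℚ) → Σ-Fin n f ≡ sum f
Σ-Fin≡sum zero    f = refl
Σ-Fin≡sum (suc n) f = cong (f zero +_) (Σ-Fin≡sum n (f ∘ suc))

Σ-cong : ∀ n {f g : Fin n → ℚ} → (∀ i → f i ≡ g i) → Σ-Fin n f ≡ Σ-Fin n g
Σ-cong zero    _ = refl
Σ-cong (suc n) e = cong₂ _+_ (e zero) (Σ-cong n (e ∘ suc))

Σ-*ˡ : ∀ n c (f : Fin n → ℚ) → c * Σ-Fin n f ≡ Σ-Fin n (λ i → c * f i)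
Σ-*ˡ n c f = begin
  c * Σ-Fin n f             ≡⟨ cong (c *_) (Σ-Fin≡sum n f) ⟩
  c * sum f                 ≡⟨ *-distribˡ-sum c f ⟩
  sum (λ i → c * f i)       ≡⟨ Σ-Fin≡sum n _ ⟨
  Σ-Fin n (λ i → c * f i)   ∎
  where open ≡-Reasoning

Σ-*ʳ : ∀ n c (f : Fin n → ℚ) → Σ-Fin n f * c ≡ Σ-Fin n (λ i → f i * c)
Σ-*ʳ n c f = begin
  Σ-Fin n f * c             ≡⟨ cong (_* c) (Σ-Fin≡sum n f) ⟩
  sum f * c                 ≡⟨ *-distribʳ-sum c f ⟩
  sum (λ i → f i * c)       ≡⟨ Σ-Fin≡sum n _ ⟨
  Σ-Fin n (λ i → f i * c)   ∎
  where open ≡-Reasoning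

Σ-+ : ∀ n (f g : Fin n → ℚ) → Σ-Fin n (λ i → f i + g i) ≡ Σ-Fin n f + Σ-Fin n g
Σ-+ n f g = begin
  Σ-Fin n (λ i → f i + g i)  ≡⟨ Σ-Fin≡sum n _ ⟩
  sum (λ i → f i + g i)      ≡⟨ ∑-distrib-+ f g ⟩
  sum f + sum g              ≡⟨ cong₂ _+_ (Σ-Fin≡sum n f) (Σ-Fin≡sum n g) ⟨
  Σ-Fin n f + Σ-Fin n g      ∎
  where open ≡-Reasoning

Σ-swap : ∀ n m (f : Fin n → Fin m → ℚ) →
  Σ-Fin n (λ i → Σ-Fin m (f i)) ≡ Σ-Fin m (λ j → Σ-Fin n (λ i → f i j))
Σ-swap n m f = begin
  Σ-Fin n (λ i → Σ-Fin m (f i))             ≡⟨ Σ-cong n (λ i → Σ-Fin≡sum m (f i)) ⟩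
  Σ-Fin n (λ i → sum (f i))                 ≡⟨ Σ-Fin≡sum n _ ⟩
  sum (λ i → sum (f i))                     ≡⟨ ∑-comm f ⟩
  sum (λ j → sum (λ i → f i j))             ≡⟨ Σ-Fin≡sum m _ ⟨
  Σ-Fin m (λ j → sum (λ i → f i j))         ≡⟨ Σ-cong m (λ j → Σ-Fin≡sum n (λ i → f i j)) ⟨
  Σ-Fin m (λ j → Σ-Fin n (λ i → f i j))     ∎
  where open ≡-Reasoning

Σ-neg : ∀ n (f : Fin n → ℚ) → - Σ-Fin n f ≡ Σ-Fin n (λ i → - f i)
Σ-neg zero    f = refl
Σ-neg (suc n) f = trans (ℚ.neg-distrib-+ (f zero) _) (cong (- f zero +_) (Σ-neg n (f ∘ suc)))

Σ-- : ∀ n (f g : Fin n → ℚ) → Σ-Fin n (λ i → f i - g i) ≡ Σ-Fin n f - Σ-Fin n g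
Σ-- n f g = trans (Σ-+ n f (λ i → - g i)) (cong (Σ-Fin n f +_) (sym (Σ-neg n g)))

Σ-zero : ∀ n (f : Fin n → ℚ) → (∀ i → f i ≡ 0ℚ) → Σ-Fin n f ≡ 0ℚ
Σ-zero zero    f _  = refl
Σ-zero (suc n) f z0 = cong₂ _+_ (z0 zero) (Σ-zero n (f ∘ suc) (z0 ∘ suc))

Σ-single : ∀ n (f : Fin n → ℚ) c → (∀ i → i ≢ c → f i ≡ 0ℚ) → Σ-Fin n f ≡ f c
Σ-single (suc n) f zero    z0 =
  trans (cong (f zero +_) (Σ-zero n (f ∘ suc) (λ i → z0 (suc i) λ ()))) (ℚ.+-identityʳ (f zero))
Σ-single (suc n) f (suc c) z0 =
  trans (cong₂ _+_ (z0 zero λ ()) (Σ-single n (f ∘ suc) c (λ i i≢c → z0 (suc i) (i≢c ∘ suc-injective))))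
        (ℚ.+-identityˡ (f (suc c)))

Σ-𝟙-unique : ∀ n {P : Fin n → Set} (P? : ∀ k → Dec (P k)) (f : Fin n → ℚ) c →
  P c → (∀ k → P k → k ≡ c) → Σ-Fin n (λ k → 𝟙 (P? k) * f k) ≡ f c
Σ-𝟙-unique n P? f c pc unique = begin
  Σ-Fin n (λ k → 𝟙 (P? k) * f k)   ≡⟨ Σ-single n _ c (λ k k≢c → trans (cong (_* f k) (𝟙-no (P? k) (k≢c ∘ unique k))) (ℚ.*-zeroˡ (f k))) ⟩
  𝟙 (P? c) * f c                   ≡⟨ cong (_* f c) (𝟙-yes (P? c) pc) ⟩
  1ℚ * f c                         ≡⟨ ℚ.*-identityˡ (f c) ⟩
  f c                              ∎
  where open ≡-Reasoning

Σ-𝟙-none : ∀ n {P : Fin n → Set} (P? : ∀ k → Dec (P k)) (f : Fin n → ℚ) →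
  (∀ k → ¬ P k) → Σ-Fin n (λ k → 𝟙 (P? k) * f k) ≡ 0ℚ
Σ-𝟙-none n P? f none = Σ-zero n _ (λ k → trans (cong (_* f k) (𝟙-no (P? k) (none k))) (ℚ.*-zeroˡ (f k)))

Σ-𝟙𝟙-unique : ∀ n {P Q : Fin n → Set} (P? : ∀ k → Dec (P k)) (Q? : ∀ k → Dec (Q k)) c →
  P c → Q c → (∀ k → P k → Q k → k ≡ c) → Σ-Fin n (λ k → 𝟙 (P? k) * 𝟙 (Q? k)) ≡ 1ℚ
Σ-𝟙𝟙-unique n P? Q? c pc qc unique = trans
  (Σ-cong n (λ k → trans (𝟙-× (P? k) (Q? k)) (sym (ℚ.*-identityʳ _))))
  (Σ-𝟙-unique n (λ k → P? k ×-dec Q? k) (λ _ → 1ℚ) c (pc , qc) (λ k (pk , qk) → unique k pk qk))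

Σ-𝟙𝟙-none : ∀ n {P Q : Fin n → Set} (P? : ∀ k → Dec (P k)) (Q? : ∀ k → Dec (Q k)) →
  (∀ k → P k → Q k → ⊥) → Σ-Fin n (λ k → 𝟙 (P? k) * 𝟙 (Q? k)) ≡ 0ℚ
Σ-𝟙𝟙-none n P? Q? none = trans
  (Σ-cong n (λ k → trans (𝟙-× (P? k) (Q? k)) (sym (ℚ.*-identityʳ _))))
  (Σ-𝟙-none n (λ k → P? k ×-dec Q? k) (λ _ → 1ℚ) (λ k (pk , qk) → none k pk qk))

reciprocal : (q : ℚ) → .(q ≢ 0ℚ) → ℚ
reciprocal q q≢0 = (1/ q) {{≢-nonZero q≢0}}

reciprocal-inverseʳ : ∀ q .(q≢0 : q ≢ 0ℚ) → q * reciprocal q q≢0 ≡ 1ℚ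
reciprocal-inverseʳ q q≢0 = ℚ.*-inverseʳ q {{≢-nonZero q≢0}}

reciprocal-inverseˡ : ∀ q .(q≢0 : q ≢ 0ℚ) → reciprocal q q≢0 * q ≡ 1ℚ
reciprocal-inverseˡ q q≢0 = ℚ.*-inverseˡ q {{≢-nonZero q≢0}}

reciprocal≢0 : ∀ q .(q≢0 : q ≢ 0ℚ) → reciprocal q q≢0 ≢ 0ℚ
reciprocal≢0 q q≢0 r≡0 = ℚ.1≢0 (begin
  1ℚ                      ≡⟨ reciprocal-inverseʳ q q≢0 ⟨
  q * reciprocal q q≢0    ≡⟨ cong (q *_) r≡0 ⟩
  q * 0ℚ                  ≡⟨ ℚ.*-zeroʳ q ⟩
  0ℚ                      ∎)
  where open ≡-Reasoning

reciprocal-injective : ∀ p q .(p≢0 : p ≢ 0ℚ) .(q≢0 : q ≢ 0ℚ) →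
  reciprocal p p≢0 ≡ reciprocal q q≢0 → p ≡ q
reciprocal-injective p q p≢0 q≢0 p⁻¹≡q⁻¹ = begin
  p                  ≡⟨ ℚ.*-identityʳ p ⟨
  p * 1ℚ             ≡⟨ cong (p *_) (reciprocal-inverseˡ q q≢0) ⟨
  p * (q⁻¹ * q)      ≡⟨ cong (λ r → p * (r * q)) p⁻¹≡q⁻¹ ⟨
  p * (p⁻¹ * q)      ≡⟨ ℚ.*-assoc p p⁻¹ q ⟨
  p * p⁻¹ * q        ≡⟨ cong (_* q) (reciprocal-inverseʳ p p≢0) ⟩
  1ℚ * q             ≡⟨ ℚ.*-identityˡ q ⟩
  q                  ∎
  where
  open ≡-Reasoning
  p⁻¹ = reciprocal p p≢0
  q⁻¹ = reciprocal q q≢0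

add-sub-cancel : ∀ p q → p + q - q ≡ p
add-sub-cancel = solve 2 (λ p q → p :+ q :+ :- q := p) refl

ℕtoℚ≡mkℚ : ∀ m → ℕtoℚ m ≡ mkℚ (+ℤ m) 0 (Coprime-sym (1-coprimeTo m))
ℕtoℚ≡mkℚ m = ℚ.normalize-coprime (Coprime-sym (1-coprimeTo m))

ℕtoℚ-* : ∀ a b → ℕtoℚ a * ℕtoℚ b ≡ ℕtoℚ (a ℕ.* b)
ℕtoℚ-* a b rewrite ℕtoℚ≡mkℚ a | ℕtoℚ≡mkℚ b = cong (_/ 1) (sym (ℤ.pos-* a b))

ℕtoℚ-injective : ∀ {a b} → ℕtoℚ a ≡ ℕtoℚ b → a ≡ b
ℕtoℚ-injective {a} {b} eq = ℤ.+-injective (cong ↥_ (trans (sym (ℕtoℚ≡mkℚ a)) (trans eq (ℕtoℚ≡mkℚ b))))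

lcm-as-quotient : ∀ a b g → g ≡ gcd a b → .(g≢0 : ℕtoℚ g ≢ 0ℚ) →
  ℕtoℚ a * ℕtoℚ b * reciprocal (ℕtoℚ g) g≢0 ≡ ℕtoℚ (lcm a b)
lcm-as-quotient a b g refl g≢0 = begin
  ℕtoℚ a * ℕtoℚ b * g⁻¹           ≡⟨ cong (_* g⁻¹) (ℕtoℚ-* a b) ⟩
  ℕtoℚ (a ℕ.* b) * g⁻¹            ≡⟨ cong (λ m → ℕtoℚ m * g⁻¹) (gcd*lcm a b) ⟨
  ℕtoℚ (gcd a b ℕ.* l) * g⁻¹      ≡⟨ cong (_* g⁻¹) (ℕtoℚ-* (gcd a b) l) ⟨
  ℕtoℚ (gcd a b) * ℕtoℚ l * g⁻¹   ≡⟨ solve 3 (λ G L R → G :* L :* R := L :* (G :* R)) refl (ℕtoℚ (gcd a b)) (ℕtoℚ l) g⁻¹ ⟩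
  ℕtoℚ l * (ℕtoℚ (gcd a b) * g⁻¹) ≡⟨ cong (ℕtoℚ l *_) (reciprocal-inverseʳ (ℕtoℚ (gcd a b)) g≢0) ⟩
  ℕtoℚ l * 1ℚ                     ≡⟨ ℚ.*-identityʳ (ℕtoℚ l) ⟩
  ℕtoℚ l                          ∎
  where
  open ≡-Reasoning
  l = lcm a b
  g⁻¹ = reciprocal (ℕtoℚ (gcd a b)) g≢0

Vector : ℕ → Set
Vector n = Fin n → ℚ

infix  4 _≐_
infixl 10 _⊖_
infix  30 _ᵀ

_≐_ : ∀ {n} → Matrix n → Matrix n → Set
A ≐ B = ∀ i j → A i j ≡ B i j

_⊙_ : ∀ {n} → Matrix n → Vector n → Vector n
_⊙_ {n} A v i = Σ-Fin n (λ k → A i k * v k)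

column : ∀ {n} → Matrix n → Fin n → Vector n
column B j k = B k j

_ᵀ : ∀ {n} → Matrix n → Matrix n
(A ᵀ) i j = A j i

_⊖_ : ∀ {n} → Matrix n → Matrix n → Matrix n
(A ⊖ B) i j = A i j - B i j

identity≡𝟙 : ∀ {n} (i j : Fin n) → identity i j ≡ 𝟙 (i ≟ᶠ j)
identity≡𝟙 zero    zero    = refl
identity≡𝟙 zero    (suc j) = refl
identity≡𝟙 (suc i) zero    = refl
identity≡𝟙 (suc i) (suc j) with i ≟ᶠ j
... | yes refl = trans (identity≡𝟙 i i) (𝟙-yes (i ≟ᶠ i) refl)
... | no i≢j   = trans (identity≡𝟙 i j) (𝟙-no (i ≟ᶠ j) i≢j)

identity-symmetric : ∀ {n} → (identity {n}) ᵀ ≐ identity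
identity-symmetric zero    zero    = refl
identity-symmetric zero    (suc j) = refl
identity-symmetric (suc i) zero    = refl
identity-symmetric (suc i) (suc j) = identity-symmetric i j

identity-diagonal : ∀ {n} (i : Fin n) → identity i i ≡ 1ℚ
identity-diagonal i = trans (identity≡𝟙 i i) (𝟙-yes (i ≟ᶠ i) refl)

identity-off-diagonal : ∀ {n} {i j : Fin n} → i ≢ j → identity i j ≡ 0ℚ
identity-off-diagonal {i = i} {j} i≢j = trans (identity≡𝟙 i j) (𝟙-no (i ≟ᶠ j) i≢j)

⊙-congˡ : ∀ {n} {A A′ : Matrix n} → A ≐ A′ → ∀ v i → (A ⊙ v) i ≡ (A′ ⊙ v) i
⊙-congˡ {n} A≐A′ v i = Σ-cong n (λ k → cong (_* v k) (A≐A′ i k))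

⊙-identity : ∀ {n} (v : Vector n) i → (identity ⊙ v) i ≡ v i
⊙-identity {n} v i = trans (Σ-cong n (λ k → cong (_* v k) (identity≡𝟙 i k)))
                           (Σ-𝟙-unique n (i ≟ᶠ_) v i refl (λ k → sym))

⊙-assoc : ∀ {n} (A B : Matrix n) (v : Vector n) i → (A ⊙ (B ⊙ v)) i ≡ ((A ⊗ B) ⊙ v) i
⊙-assoc {n} A B v i = begin
  Σ-Fin n (λ k → A i k * Σ-Fin n (λ l → B k l * v l))     ≡⟨ Σ-cong n (λ k → Σ-*ˡ n (A i k) _) ⟩
  Σ-Fin n (λ k → Σ-Fin n (λ l → A i k * (B k l * v l)))   ≡⟨ Σ-swap n n _ ⟩
  Σ-Fin n (λ l → Σ-Fin n (λ k → A i k * (B k l * v l)))   ≡⟨ Σ-cong n (λ l → Σ-cong n (λ k → sym (ℚ.*-assoc (A i k) (B k l) (v l)))) ⟩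
  Σ-Fin n (λ l → Σ-Fin n (λ k → A i k * B k l * v l))     ≡⟨ Σ-cong n (λ l → Σ-*ʳ n (v l) _) ⟨
  Σ-Fin n (λ l → (A ⊗ B) i l * v l)                       ∎
  where open ≡-Reasoning

⊗-assoc : ∀ {n} (A B C : Matrix n) → (A ⊗ B) ⊗ C ≐ A ⊗ (B ⊗ C)
⊗-assoc A B C i j = sym (⊙-assoc A B (column C j) i)

⊗-identityˡ : ∀ {n} (A : Matrix n) → identity ⊗ A ≐ A
⊗-identityˡ A i j = ⊙-identity (column A j) i

⊗-congˡ : ∀ {n} {A A′ : Matrix n} (B : Matrix n) → A ≐ A′ → A ⊗ B ≐ A′ ⊗ B
⊗-congˡ B A≐A′ i j = ⊙-congˡ A≐A′ (column B j) i

⊗-congʳ : ∀ {n} (A : Matrix n) {B B′ : Matrix n} → B ≐ B′ → A ⊗ B ≐ A ⊗ B′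
⊗-congʳ {n} A e i j = Σ-cong n (λ k → cong (A i k *_) (e k j))

ᵀ-⊗ : ∀ {n} (A B : Matrix n) → (A ⊗ B) ᵀ ≐ B ᵀ ⊗ A ᵀ
ᵀ-⊗ {n} A B i j = Σ-cong n (λ k → ℚ.*-comm (A j k) (B k i))

⊗-identityʳ : ∀ {n} (A : Matrix n) → A ⊗ identity ≐ A
⊗-identityʳ A i j = begin
  (A ⊗ identity) i j                ≡⟨ ᵀ-⊗ A identity j i ⟩
  (identity ᵀ ⊗ A ᵀ) j i            ≡⟨ ⊗-congˡ (A ᵀ) identity-symmetric j i ⟩
  (identity ⊗ A ᵀ) j i              ≡⟨ ⊗-identityˡ (A ᵀ) j i ⟩
  A i j                             ∎
  where open ≡-Reasoning

⊙-distribʳ-⊖ : ∀ {n} (A B : Matrix n) (v : Vector n) i → ((A ⊖ B) ⊙ v) i ≡ (A ⊙ v) i - (B ⊙ v) i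
⊙-distribʳ-⊖ {n} A B v i = trans
  (Σ-cong n (λ k → solve 3 (λ a b c → (a :+ :- b) :* c := a :* c :+ :- (b :* c)) refl (A i k) (B i k) (v k)))
  (Σ-- n _ _)

⊗-distribʳ-⊖ : ∀ {n} (A B C : Matrix n) → (A ⊖ B) ⊗ C ≐ A ⊗ C ⊖ B ⊗ C
⊗-distribʳ-⊖ A B C i j = ⊙-distribʳ-⊖ A B (column C j) i

⊗-distribˡ-⊖ : ∀ {n} (A B C : Matrix n) → A ⊗ (B ⊖ C) ≐ A ⊗ B ⊖ A ⊗ C
⊗-distribˡ-⊖ {n} A B C i j = trans
  (Σ-cong n (λ k → solve 3 (λ a b c → a :* (b :+ :- c) := a :* b :+ :- (a :* c)) refl (A i k) (B k j) (C k j)))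
  (Σ-- n _ _)

diag : ∀ {n} → Vector n → Matrix n
diag d i j = d i * identity i j

diag-⊗ : ∀ {n} (d : Vector n) (A : Matrix n) i j → (diag d ⊗ A) i j ≡ d i * A i j
diag-⊗ {n} d A i j = begin
  Σ-Fin n (λ k → d i * identity i k * A k j)     ≡⟨ Σ-cong n (λ k → ℚ.*-assoc (d i) (identity i k) (A k j)) ⟩
  Σ-Fin n (λ k → d i * (identity i k * A k j))   ≡⟨ Σ-*ˡ n (d i) _ ⟨
  d i * (identity ⊗ A) i j                       ≡⟨ cong (d i *_) (⊗-identityˡ A i j) ⟩
  d i * A i j                                    ∎
  where open ≡-Reasoning

⊗-diag : ∀ {n} (A : Matrix n) (d : Vector n) i j → (A ⊗ diag d) i j ≡ A i j * d j
⊗-diag {n} A d i j = begin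
  Σ-Fin n (λ k → A i k * (d k * identity k j))   ≡⟨ Σ-cong n (λ k → sym (ℚ.*-assoc (A i k) (d k) (identity k j))) ⟩
  ((λ i k → A i k * d k) ⊗ identity) i j         ≡⟨ ⊗-identityʳ (λ i k → A i k * d k) i j ⟩
  A i j * d j                                    ∎
  where open ≡-Reasoning

invertible-resp : ∀ {n} {A A′ : Matrix n} → A ≐ A′ → Invertible A → Invertible A′
invertible-resp A≐A′ (B , AB , BA) =
  B , (λ i j → trans (sym (⊗-congˡ B A≐A′ i j)) (AB i j)) ,
      (λ i j → trans (sym (⊗-congʳ B A≐A′ i j)) (BA i j))

⊗-cancel-middle : ∀ {n} (A B B′ C : Matrix n) → B ⊗ B′ ≐ identity → (A ⊗ B) ⊗ (B′ ⊗ C) ≐ A ⊗ C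
⊗-cancel-middle A B B′ C BB′ i j = begin
  ((A ⊗ B) ⊗ (B′ ⊗ C)) i j   ≡⟨ ⊗-assoc A B (B′ ⊗ C) i j ⟩
  (A ⊗ (B ⊗ (B′ ⊗ C))) i j   ≡⟨ ⊗-congʳ A (λ k l → sym (⊗-assoc B B′ C k l)) i j ⟩
  (A ⊗ ((B ⊗ B′) ⊗ C)) i j   ≡⟨ ⊗-congʳ A (⊗-congˡ C BB′) i j ⟩
  (A ⊗ (identity ⊗ C)) i j   ≡⟨ ⊗-congʳ A (⊗-identityˡ C) i j ⟩
  (A ⊗ C) i j                ∎
  where open ≡-Reasoning

invertible-⊗ : ∀ {n} {A B : Matrix n} → Invertible A → Invertible B → Invertible (A ⊗ B)
invertible-⊗ {A = A} {B} (A⁻¹ , AA⁻¹ , A⁻¹A) (B⁻¹ , BB⁻¹ , B⁻¹B) =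
  B⁻¹ ⊗ A⁻¹ ,
  (λ i j → trans (⊗-cancel-middle A B B⁻¹ A⁻¹ BB⁻¹ i j) (AA⁻¹ i j)) ,
  (λ i j → trans (⊗-cancel-middle B⁻¹ A⁻¹ A B A⁻¹A i j) (B⁻¹B i j))

invertible-ᵀ : ∀ {n} {A : Matrix n} → Invertible A → Invertible (A ᵀ)
invertible-ᵀ {A = A} (B , AB , BA) =
  B ᵀ , (λ i j → trans (sym (ᵀ-⊗ B A i j)) (trans (BA j i) (identity-symmetric i j))) ,
        (λ i j → trans (sym (ᵀ-⊗ A B i j)) (trans (AB j i) (identity-symmetric i j)))

invertible-diag : ∀ {n} (d : Vector n) → (∀ i → d i ≢ 0ℚ) → Invertible (diag d)
invertible-diag d d≢0 = diag d⁻¹ , cancel d d⁻¹ (λ i → reciprocal-inverseʳ (d i) (d≢0 i))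
                                 , cancel d⁻¹ d (λ i → reciprocal-inverseˡ (d i) (d≢0 i))
  where
  d⁻¹ : Vector _
  d⁻¹ i = reciprocal (d i) (d≢0 i)
  cancel : ∀ (e e′ : Vector _) → (∀ i → e i * e′ i ≡ 1ℚ) → diag e ⊗ diag e′ ≐ identity
  cancel e e′ ee′ i j = begin
    (diag e ⊗ diag e′) i j           ≡⟨ diag-⊗ e (diag e′) i j ⟩
    e i * (e′ i * identity i j)      ≡⟨ ℚ.*-assoc (e i) (e′ i) (identity i j) ⟨
    e i * e′ i * identity i j        ≡⟨ cong (_* identity i j) (ee′ i) ⟩
    1ℚ * identity i j                ≡⟨ ℚ.*-identityˡ (identity i j) ⟩
    identity i j                     ∎
    where open ≡-Reasoning

linked⇒unique : ∀ {A : Set} {R : A → A → Set} {xs : List A} →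
  Transitive R → (∀ {u} → ¬ R u u) → Linked R xs → Unique xs
linked⇒unique trans irrefl linked =
  AllPairs.map (λ { r refl → irrefl r }) (Linked⇒AllPairs trans linked)

linked⇒chain : ∀ {n} {E : Fin n → Fin n → Set} {vs : List (Fin n)} → Linked E vs → Chain E vs
linked⇒chain []      = tt
linked⇒chain [-]     = tt
linked⇒chain (e ∷ l) = e , linked⇒chain l

last-++ : ∀ {A : Set} (y : A) xs z zs → last (y ∷ xs ++ z ∷ zs) ≡ last (z ∷ zs)
last-++ y []       z zs = refl
last-++ y (w ∷ xs) z zs = last-++ w xs z zs

length-++-∷ : ∀ {A : Set} (xs : List A) y ys → 0 < length (xs ++ y ∷ ys)
length-++-∷ []      y ys = z<s
length-++-∷ (_ ∷ _) y ys = z<s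

module _ {n} {P : Fin n → Set} (P? : ∀ k → Dec (P k)) (f : Fin n → ℕ) where
  open Data.List.Extrema ≤-totalOrder

  private
    candidates : List (Fin n)
    candidates = filter P? (allFin n)

    candidate : ∀ {k} → P k → k ∈ candidates
    candidate pk = ∈-filter⁺ P? (∈-allFin _) pk

  maximal : ∀ {k₀} → P k₀ → Σ (Fin n) λ m → P m × (∀ k → P k → f k ≤ f m)
  maximal {k₀} pk₀ = argmax f k₀ candidates , argmax-all f pk₀ (all-filter P? (allFin n)) ,
    λ k pk → All.lookup (f[xs]≤f[argmax] k₀ candidates) (candidate pk)

  minimal : ∀ {k₀} → P k₀ → Σ (Fin n) λ m → P m × (∀ k → P k → f m ≤ f k)
  minimal {k₀} pk₀ = argmin f k₀ candidates , argmin-all f pk₀ (all-filter P? (allFin n)) ,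
    λ k pk → All.lookup (f[argmin]≤f[xs] k₀ candidates) (candidate pk)

-- The divisibility order on a finite set of distinct positive integers

module DivisibilityOrder {n} (x : Fin n → ℕ) (x-injective : Injective _≡_ _≡_ x)
                         (x-positive : ∀ i → 0 < x i) where

  infix 4 _≼_ _≼?_ _≺_ _≺?_ _⋗_ _⋗?_

  _≼_ : Fin n → Fin n → Set
  i ≼ j = x i ∣ x j

  _≼?_ : ∀ i j → Dec (i ≼ j)
  i ≼? j = x i ∣? x j

  _≺_ : Fin n → Fin n → Set
  i ≺ j = i ≼ j × i ≢ j

  _≺?_ : ∀ i j → Dec (i ≺ j)
  i ≺? j = (i ≼? j) ×-dec ¬? (i ≟ᶠ j)

  -- i ⋗ j: i covers j, i.e. j is a lower cover of i.
  _⋗_ : Fin n → Fin n → Set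
  i ⋗ j = Covers x i j

  _⋗?_ : ∀ i j → Dec (i ⋗ j)
  i ⋗? j = (x j ∣? x i) ×-dec ¬? (x j ≟ x i) ×-dec
           all? (λ k → (x j ∣? x k) →-dec (x k ∣? x i) →-dec ((x k ≟ x j) ⊎-dec (x k ≟ x i)))

  ≼-refl : ∀ {i} → i ≼ i
  ≼-refl = ∣-refl

  ≼-trans : ∀ {i j k} → i ≼ j → j ≼ k → i ≼ k
  ≼-trans = ∣-trans

  ≼-antisym : ∀ {i j} → i ≼ j → j ≼ i → i ≡ j
  ≼-antisym i≼j j≼i = x-injective (∣-antisym i≼j j≼i)

  ≺⇒< : ∀ {i j} → i ≺ j → x i < x j
  ≺⇒< {i} {j} (i≼j , i≢j) = ≤∧≢⇒< (∣⇒≤ {{>-nonZero (x-positive j)}} i≼j) (i≢j ∘ x-injective)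

  ≼-≺-irrefl : ∀ {i j} → i ≼ j → j ≺ i → ⊥
  ≼-≺-irrefl i≼j (j≼i , j≢i) = j≢i (≼-antisym j≼i i≼j)

  ≺-trans : ∀ {i j k} → i ≺ j → j ≺ k → i ≺ k
  ≺-trans (i≼j , i≢j) (j≼k , j≢k) =
    ≼-trans i≼j j≼k , λ { refl → ≼-≺-irrefl i≼j (j≼k , j≢k) }

  ≺-≼-trans : ∀ {i j k} → i ≺ j → j ≼ k → i ≺ k
  ≺-≼-trans (i≼j , i≢j) j≼k = ≼-trans i≼j j≼k , λ { refl → ≼-≺-irrefl j≼k (i≼j , i≢j) }

  ≼-≺-trans : ∀ {i j k} → i ≼ j → j ≺ k → i ≺ k
  ≼-≺-trans i≼j (j≼k , j≢k) = ≼-trans i≼j j≼k , λ { refl → ≼-≺-irrefl i≼j (j≼k , j≢k) }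

  ≺-irrefl : ∀ {i} → ¬ i ≺ i
  ≺-irrefl (_ , i≢i) = i≢i refl

  ⋗⇒≺ : ∀ {i j} → i ⋗ j → j ≺ i
  ⋗⇒≺ (j≼i , xj≢xi , _) = j≼i , xj≢xi ∘ cong x

  ⋗-saturated : ∀ {i j k} → i ⋗ j → j ≼ k → k ≼ i → k ≡ j ⊎ k ≡ i
  ⋗-saturated {i} {j} {k} (_ , _ , between) j≼k k≼i with between k j≼k k≼i
  ... | inj₁ xk≡xj = inj₁ (x-injective xk≡xj)
  ... | inj₂ xk≡xi = inj₂ (x-injective xk≡xi)

  ⋗-intro : ∀ {i j} → j ≺ i → (∀ k → j ≺ k → k ≺ i → ⊥) → i ⋗ j
  ⋗-intro {i} {j} (j≼i , j≢i) nothing-between = j≼i , j≢i ∘ x-injective , between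
    where
    between : ∀ k → j ≼ k → k ≼ i → x k ≡ x j ⊎ x k ≡ x i
    between k j≼k k≼i with k ≟ᶠ j | k ≟ᶠ i
    ... | yes refl | _        = inj₁ refl
    ... | no _     | yes refl = inj₂ refl
    ... | no k≢j   | no k≢i   = ⊥-elim (nothing-between k (j≼k , k≢j ∘ sym) (k≼i , k≢i))

  lowerCover : ∀ {i j} → j ≺ i → Σ (Fin n) λ c → i ⋗ c × j ≼ c
  lowerCover {i} {j} j≺i with maximal (λ c → (j ≼? c) ×-dec (c ≺? i)) x (≼-refl , j≺i)
  ... | m , (j≼m , m≺i) , largest =
    m , ⋗-intro m≺i (λ k m≺k k≺i → <-irrefl refl (<-≤-trans (≺⇒< m≺k) (largest k (≼-trans j≼m (proj₁ m≺k) , k≺i)))) , j≼m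

  upperCover : ∀ {i j} → j ≺ i → Σ (Fin n) λ c → c ⋗ j × c ≼ i
  upperCover {i} {j} j≺i with minimal (λ c → (j ≺? c) ×-dec (c ≼? i)) x (j≺i , ≼-refl)
  ... | m , (j≺m , m≼i) , smallest =
    m , ⋗-intro j≺m (λ k j≺k k≺m → <-irrefl refl (<-≤-trans (≺⇒< k≺m) (smallest k (j≺k , ≼-trans (proj₁ k≺m) m≼i)))) , m≼i

  -- Saturated chains.  A descent from a to g is a = u₀ ⋗ u₁ ⋗ ⋯ ⋗ u_k = g;
  -- an ascent from g to b is g ⋖ w₁ ⋖ ⋯ ⋖ w_k = b (only w₁ … w_k are listed).
  _⋖_ : Fin n → Fin n → Set
  i ⋖ j = j ⋗ i

  record Descent (a g : Fin n) : Set where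
    field
      chain   : List (Fin n)
      linked  : Linked _⋗_ (a ∷ chain)
      ends    : last (a ∷ chain) ≡ just g
      between : All (λ u → g ≼ u × u ≼ a) (a ∷ chain)

  record Ascent (g b : Fin n) : Set where
    field
      chain   : List (Fin n)
      linked  : Linked _⋖_ (g ∷ chain)
      ends    : last (g ∷ chain) ≡ just b
      between : All (λ w → g ≺ w × w ≼ b) chain

  descent : ∀ {g} a → Acc _<_ (x a) → g ≼ a → Descent a g
  descent {g} a (acc smaller) g≼a with a ≟ᶠ g
  ... | yes refl = record { chain = [] ; linked = [-] ; ends = refl ; between = (≼-refl , ≼-refl) ∷ [] }
  ... | no a≢g with lowerCover (g≼a , a≢g ∘ sym)
  ...   | c , a⋗c , g≼c = record
    { chain   = c ∷ D.chain
    ; linked  = a⋗c ∷ D.linked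
    ; ends    = D.ends
    ; between = (g≼a , ≼-refl) ∷ All.map (λ (g≼u , u≼c) → g≼u , ≼-trans u≼c c≼a) D.between
    }
    where
    c≼a = proj₁ (⋗⇒≺ a⋗c)
    module D = Descent (descent c (smaller (≺⇒< (⋗⇒≺ a⋗c))) g≼c)

  ascent : ∀ g {b} → Acc _<_ (x b ∸ x g) → g ≼ b → Ascent g b
  ascent g {b} (acc smaller) g≼b with g ≟ᶠ b
  ... | yes refl = record { chain = [] ; linked = [-] ; ends = refl ; between = [] }
  ... | no g≢b with upperCover (g≼b , g≢b)
  ...   | c , c⋗g , c≼b = record
    { chain   = c ∷ U.chain
    ; linked  = c⋗g ∷ U.linked
    ; ends    = U.ends
    ; between = (g≺c , c≼b) ∷ All.map (λ (c≺w , w≼b) → ≺-trans g≺c c≺w , w≼b) U.between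
    }
    where
    g≺c = ⋗⇒≺ c⋗g
    module U = Ascent (ascent c (smaller (∸-monoʳ-< (≺⇒< g≺c) (∣⇒≤ {{>-nonZero (x-positive b)}} c≼b))) c≼b)

  -- GCD closed ∧-tree sets: the down-set of every element is a chain

  module WedgeTree (gcd-closed : GCDClosed x) (acyclic : Acyclic (HasseAdj x)) where

    meet : Fin n → Fin n → Fin n
    meet a b = proj₁ (gcd-closed a b)

    meet≼ˡ : ∀ a b → meet a b ≼ a
    meet≼ˡ a b = subst (_∣ x a) (sym (proj₂ (gcd-closed a b))) (gcd[m,n]∣m (x a) (x b))

    meet≼ʳ : ∀ a b → meet a b ≼ b
    meet≼ʳ a b = subst (_∣ x b) (sym (proj₂ (gcd-closed a b))) (gcd[m,n]∣n (x a) (x b))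

    meet-greatest : ∀ {a b k} → k ≼ a → k ≼ b → k ≼ meet a b
    meet-greatest {a} {b} k≼a k≼b = subst (x _ ∣_) (sym (proj₂ (gcd-closed a b))) (gcd-greatest k≼a k≼b)

    -- Two different lower covers a, b of i, joined through a greatest common
    -- lower bound g, close a cycle in the Hasse diagram: i, down from a to g,
    -- up from g to b, and back to i.
    covers-meet-cycle : ∀ {i a b g} → i ⋗ a → i ⋗ b → a ≢ b →
      (∀ {k} → k ≼ a → k ≼ b → k ≼ g) → Descent a g → Ascent g b → ⊥
    covers-meet-cycle {i} {a} {b} i⋗a i⋗b a≢b _ D record { chain = [] ; ends = refl }
      with ⋗-saturated i⋗b (proj₁ (All.head (Descent.between D))) (proj₁ (⋗⇒≺ i⋗a))
    ... | inj₁ a≡b = a≢b a≡b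
    ... | inj₂ a≡i = proj₂ (⋗⇒≺ i⋗a) a≡i
    covers-meet-cycle {i} {a} {b} {g} i⋗a i⋗b a≢b greatest D
      record { chain = w ∷ ws ; linked = w⋗g ∷ up ; ends = ends ; between = U-between } =
      acyclic (i ∷ (a ∷ D.chain) ++ w ∷ ws)
        ( s≤s (s≤s (length-++-∷ D.chain w ws))
        , All.++⁺ (All.map (λ (_ , u≼a) → below⇒≢ (⋗⇒≺ i⋗a) u≼a) D.between)
                  (All.map (λ (_ , w≼b) → below⇒≢ (⋗⇒≺ i⋗b) w≼b) U-between)
          ∷ AllPairs.++⁺ (linked⇒unique ≻-trans ≺-irrefl (Linked.map ⋗⇒≺ D.linked))
                         (linked⇒unique ≺-trans ≺-irrefl (Linked.map ⋗⇒≺ up))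
                         (All.map (λ (_ , u≼a) → All.map (λ (g≺w , w≼b) → disjoint u≼a g≺w w≼b) U-between) D.between)
        , linked⇒chain (inj₁ i⋗a ∷ Linked.++⁺ (Linked.map inj₁ D.linked) joint (Linked.map inj₂ up))
        , b , trans (last-++ i (a ∷ D.chain) w ws) ends , inj₂ i⋗b )
      where
      module D = Descent D

      below⇒≢ : ∀ {u c} → c ≺ i → u ≼ c → i ≢ u
      below⇒≢ c≺i u≼c refl = ≼-≺-irrefl u≼c c≺i

      ≻-trans : ∀ {u v w} → v ≺ u → w ≺ v → w ≺ u
      ≻-trans v≺u w≺v = ≺-trans w≺v v≺u

      -- the descent stays below a, the ascent strictly above the meet g
      disjoint : ∀ {u w} → u ≼ a → g ≺ w → w ≼ b → u ≢ w
      disjoint u≼a g≺w w≼b refl = ≼-≺-irrefl (greatest u≼a w≼b) g≺w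

      joint : MaybeConnected (HasseAdj x) (last (a ∷ D.chain)) (just w)
      joint = subst (λ v → MaybeConnected (HasseAdj x) v (just w)) (sym D.ends) (just (inj₂ w⋗g))

    lowerCover-unique : ∀ {i a b} → i ⋗ a → i ⋗ b → a ≡ b
    lowerCover-unique {i} {a} {b} i⋗a i⋗b with a ≟ᶠ b
    ... | yes a≡b = a≡b
    ... | no a≢b  = ⊥-elim (covers-meet-cycle i⋗a i⋗b a≢b meet-greatest
                             (descent a (<-wellFounded _) (meet≼ˡ a b))
                             (ascent (meet a b) (<-wellFounded _) (meet≼ʳ a b)))

    below-lowerCover : ∀ {i c k} → i ⋗ c → k ≺ i → k ≼ c
    below-lowerCover i⋗c k≺i with lowerCover k≺i
    ... | c′ , i⋗c′ , k≼c′ = subst (_ ≼_) (lowerCover-unique i⋗c′ i⋗c) k≼c′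

    downset-chain : ∀ {i a b} → Acc _<_ (x i) → a ≼ i → b ≼ i → a ≼ b ⊎ b ≼ a
    downset-chain {i} {a} {b} (acc smaller) a≼i b≼i with a ≟ᶠ i | b ≟ᶠ i
    ... | yes refl | _        = inj₂ b≼i
    ... | no _     | yes refl = inj₁ a≼i
    ... | no a≢i   | no b≢i with lowerCover (a≼i , a≢i)
    ...   | c , i⋗c , _ = downset-chain (smaller (≺⇒< (⋗⇒≺ i⋗c)))
                            (below-lowerCover i⋗c (a≼i , a≢i)) (below-lowerCover i⋗c (b≼i , b≢i))

    comparable-covers : ∀ {j k c} → k ⋗ j → c ⋗ j → k ≼ c → k ≡ c
    comparable-covers k⋗j c⋗j k≼c with ⋗-saturated c⋗j (proj₁ (⋗⇒≺ k⋗j)) k≼c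
    ... | inj₁ k≡j = ⊥-elim (proj₂ (⋗⇒≺ k⋗j) (sym k≡j))
    ... | inj₂ k≡c = k≡c

    upperCover-unique : ∀ {i j k c} → k ⋗ j → c ⋗ j → k ≼ i → c ≼ i → k ≡ c
    upperCover-unique k⋗j c⋗j k≼i c≼i with downset-chain (<-wellFounded _) k≼i c≼i
    ... | inj₁ k≼c = comparable-covers k⋗j c⋗j k≼c
    ... | inj₂ c≼k = sym (comparable-covers c⋗j k⋗j c≼k)

    zeta cover möbius : Matrix n
    zeta i k = 𝟙 (k ≼? i)
    cover k j = 𝟙 (k ⋗? j)
    möbius = identity ⊖ cover

    zeta-split : ∀ i j → zeta i j ≡ identity i j + 𝟙 (j ≺? i)
    zeta-split i j with i ≟ᶠ j
    ... | yes refl = trans (𝟙-yes (i ≼? i) ≼-refl)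
                           (sym (cong₂ _+_ (identity-diagonal i) (𝟙-no (i ≺? i) ≺-irrefl)))
    ... | no i≢j   = trans (𝟙-cong (j ≼? i) (j ≺? i) (λ j≼i → j≼i , i≢j ∘ sym) proj₁)
                           (sym (trans (cong (_+ 𝟙 (j ≺? i)) (identity-off-diagonal i≢j)) (ℚ.+-identityˡ (𝟙 (j ≺? i)))))

    -- Below i exactly one element covers j if j ≺ i, and none otherwise.
    zeta⊗cover : ∀ i j → (zeta ⊗ cover) i j ≡ 𝟙 (j ≺? i)
    zeta⊗cover i j with j ≺? i
    ... | yes j≺i with upperCover j≺i
    ...   | c , c⋗j , c≼i = Σ-𝟙𝟙-unique n (_≼? i) (_⋗? j) c c≼i c⋗j
                              (λ k k≼i k⋗j → upperCover-unique k⋗j c⋗j k≼i c≼i)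
    zeta⊗cover i j | no j⊀i = Σ-𝟙𝟙-none n (_≼? i) (_⋗? j) (λ k k≼i k⋗j → j⊀i (≺-≼-trans (⋗⇒≺ k⋗j) k≼i))

    -- The lower cover of i lies above j exactly when j ≺ i.
    cover⊗zeta : ∀ i j → (cover ⊗ zeta) i j ≡ 𝟙 (j ≺? i)
    cover⊗zeta i j with j ≺? i
    ... | yes j≺i with lowerCover j≺i
    ...   | c , i⋗c , j≼c = Σ-𝟙𝟙-unique n (i ⋗?_) (j ≼?_) c i⋗c j≼c
                              (λ k i⋗k _ → lowerCover-unique i⋗k i⋗c)
    cover⊗zeta i j | no j⊀i = Σ-𝟙𝟙-none n (i ⋗?_) (j ≼?_) (λ k i⋗k j≼k → j⊀i (≼-≺-trans j≼k (⋗⇒≺ i⋗k)))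

    zeta⊗möbius : zeta ⊗ möbius ≐ identity
    zeta⊗möbius i j = begin
      (zeta ⊗ (identity ⊖ cover)) i j              ≡⟨ ⊗-distribˡ-⊖ zeta identity cover i j ⟩
      (zeta ⊗ identity) i j - (zeta ⊗ cover) i j   ≡⟨ cong₂ _-_ (⊗-identityʳ zeta i j) (zeta⊗cover i j) ⟩
      zeta i j - 𝟙 (j ≺? i)                        ≡⟨ cong (_- 𝟙 (j ≺? i)) (zeta-split i j) ⟩
      identity i j + 𝟙 (j ≺? i) - 𝟙 (j ≺? i)       ≡⟨ add-sub-cancel (identity i j) (𝟙 (j ≺? i)) ⟩
      identity i j                                 ∎
      where open ≡-Reasoning

    möbius⊗zeta : möbius ⊗ zeta ≐ identity
    möbius⊗zeta i j = begin
      ((identity ⊖ cover) ⊗ zeta) i j              ≡⟨ ⊗-distribʳ-⊖ identity cover zeta i j ⟩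
      (identity ⊗ zeta) i j - (cover ⊗ zeta) i j   ≡⟨ cong₂ _-_ (⊗-identityˡ zeta i j) (cover⊗zeta i j) ⟩
      zeta i j - 𝟙 (j ≺? i)                        ≡⟨ cong (_- 𝟙 (j ≺? i)) (zeta-split i j) ⟩
      identity i j + 𝟙 (j ≺? i) - 𝟙 (j ≺? i)       ≡⟨ add-sub-cancel (identity i j) (𝟙 (j ≺? i)) ⟩
      identity i j                                 ∎
      where open ≡-Reasoning

    zeta-invertible : Invertible zeta
    zeta-invertible = möbius , zeta⊗möbius , möbius⊗zeta

    X : Vector n
    X i = ℕtoℚ (x i)

    X≢0 : ∀ i → X i ≢ 0ℚ
    X≢0 i Xi≡0 = <-irrefl (sym (ℕtoℚ-injective Xi≡0)) (x-positive i)

    X⁻¹ : Vector n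
    X⁻¹ i = reciprocal (X i) (X≢0 i)

    α : Vector n
    α = möbius ⊙ X⁻¹

    Σ-below-α : ∀ m → Σ-Fin n (λ k → zeta m k * α k) ≡ X⁻¹ m
    Σ-below-α m = begin
      (zeta ⊙ (möbius ⊙ X⁻¹)) m   ≡⟨ ⊙-assoc zeta möbius X⁻¹ m ⟩
      ((zeta ⊗ möbius) ⊙ X⁻¹) m   ≡⟨ ⊙-congˡ zeta⊗möbius X⁻¹ m ⟩
      (identity ⊙ X⁻¹) m          ≡⟨ ⊙-identity X⁻¹ m ⟩
      X⁻¹ m                       ∎
      where open ≡-Reasoning

    α-value : ∀ k → α k ≡ X⁻¹ k - (cover ⊙ X⁻¹) k
    α-value k = trans (⊙-distribʳ-⊖ identity cover X⁻¹ k) (cong (_- (cover ⊙ X⁻¹) k) (⊙-identity X⁻¹ k))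

    cover-sum : ∀ {k c} → k ⋗ c → (cover ⊙ X⁻¹) k ≡ X⁻¹ c
    cover-sum {k} k⋗c = Σ-𝟙-unique n (k ⋗?_) X⁻¹ _ k⋗c (λ l k⋗l → lowerCover-unique k⋗l k⋗c)

    -- α_k = 1/x_k − 1/x_c for the lower cover c of k, and α_k = 1/x_k if k has
    -- none; either way α_k ≠ 0 since the x_i are distinct.
    α≢0 : ∀ k → α k ≢ 0ℚ
    α≢0 k αk≡0 with any? (k ⋗?_)
    ... | yes (c , k⋗c) = proj₂ (⋗⇒≺ k⋗c) (sym (x-injective (ℕtoℚ-injective
          (reciprocal-injective (X k) (X c) (X≢0 k) (X≢0 c) (x∙y⁻¹≈ε⇒x≈y _ _ (begin
            X⁻¹ k - X⁻¹ c                ≡⟨ cong (λ q → X⁻¹ k - q) (cover-sum k⋗c) ⟨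
            X⁻¹ k - (cover ⊙ X⁻¹) k      ≡⟨ α-value k ⟨
            α k                          ≡⟨ αk≡0 ⟩
            0ℚ                           ∎))))))
      where open ≡-Reasoning
    ... | no minimal-k = reciprocal≢0 (X k) (X≢0 k) (begin
            X⁻¹ k                        ≡⟨ ℚ.+-identityʳ (X⁻¹ k) ⟨
            X⁻¹ k - 0ℚ                   ≡⟨ cong (λ q → X⁻¹ k - q) (Σ-𝟙-none n (k ⋗?_) X⁻¹ (λ l k⋗l → minimal-k (l , k⋗l))) ⟨
            X⁻¹ k - (cover ⊙ X⁻¹) k      ≡⟨ α-value k ⟨
            α k                          ≡⟨ αk≡0 ⟩
            0ℚ                           ∎)
      where open ≡-Reasoning

    zeta-meet : ∀ i j k → zeta i k * zeta j k ≡ zeta (meet i j) k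
    zeta-meet i j k = trans (𝟙-× (k ≼? i) (k ≼? j))
      (𝟙-cong ((k ≼? i) ×-dec (k ≼? j)) (k ≼? meet i j)
              (λ (k≼i , k≼j) → meet-greatest k≼i k≼j)
              (λ k≼g → ≼-trans k≼g (meet≼ˡ i j) , ≼-trans k≼g (meet≼ʳ i j)))

    -- lcm(x_i, x_j) = x_i x_j / x_{meet i j} = x_i x_j Σ_{k ≼ i, k ≼ j} α_k
    lcm-factorisation : (diag X ⊗ zeta) ⊗ (diag α ⊗ (zeta ᵀ ⊗ diag X)) ≐ LCMMatrix x
    lcm-factorisation i j = begin
      Σ-Fin n (λ k → (diag X ⊗ zeta) i k * (diag α ⊗ (zeta ᵀ ⊗ diag X)) k j)
        ≡⟨ Σ-cong n (λ k → cong₂ _*_ (diag-⊗ X zeta i k)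
                                     (trans (diag-⊗ α (zeta ᵀ ⊗ diag X) k j) (cong (α k *_) (⊗-diag (zeta ᵀ) X k j)))) ⟩
      Σ-Fin n (λ k → X i * zeta i k * (α k * (zeta j k * X j)))
        ≡⟨ Σ-cong n (λ k → trans (rearrange (X i) (zeta i k) (α k) (zeta j k) (X j))
                                 (cong (λ z → X i * X j * (z * α k)) (zeta-meet i j k))) ⟩
      Σ-Fin n (λ k → X i * X j * (zeta g k * α k))
        ≡⟨ Σ-*ˡ n (X i * X j) _ ⟨
      X i * X j * Σ-Fin n (λ k → zeta g k * α k)
        ≡⟨ cong (X i * X j *_) (Σ-below-α g) ⟩
      X i * X j * X⁻¹ g
        ≡⟨ lcm-as-quotient (x i) (x j) (x g) (proj₂ (gcd-closed i j)) (X≢0 g) ⟩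
      LCMMatrix x i j
        ∎
      where
      open ≡-Reasoning
      g = meet i j
      rearrange : ∀ a z α′ z′ b → a * z * (α′ * (z′ * b)) ≡ a * b * (z * z′ * α′)
      rearrange = solve 5 (λ a z α′ z′ b → a :* z :* (α′ :* (z′ :* b)) := a :* b :* (z :* z′ :* α′)) refl

corollary4p8 : (n : ℕ) (x : Fin n → ℕ) →
    DistinctPositive x → GCDClosed x → MeetTreeSet x →
    Invertible (LCMMatrix x)
corollary4p8 n x (x-injective , x-positive) gcd-closed (_ , acyclic) =
  invertible-resp lcm-factorisation
    (invertible-⊗ (invertible-⊗ (invertible-diag X X≢0) zeta-invertible)
                  (invertible-⊗ (invertible-diag α α≢0)
                                (invertible-⊗ (invertible-ᵀ zeta-invertible) (invertible-diag X X≢0))))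
  where
  open DivisibilityOrder x x-injective x-positive
  open WedgeTree gcd-closed acyclic
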